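{- A finite bipartite graph $G=(S\cup T,E)$ with parts $S$ and $T$ is (isomorphic, via a map sending $S$ to the first part and $T$ to the second part, to) the incidence bipartite graph $B(D)$ of some digraph $D$ if and only if $|S|=|T|$ and $G$ admits a perfect matching.
   Context: Digraphs have no loops or multiple arcs. For a digraph $D$ with vertex set $\{x_1,\dots,x_n\}$, its incidence bipartite graph $B(D)$ is the bipartite graph with parts $\{x_1,\dots,x_n\}$ and $\{x'_1,\dots,x'_n\}$ in which $x_i$ is adjacent to $x'_j$ if and only if $\overrightarrow{x_ix_j}$ is an arc of $D$ or $i=j$. -}

module Defs where

open import Data.Nat using (ℕ)
open import Data.Fin using (Fin)
open import Data.Sum using (_⊎_)
open import Data.Product using (Σ; _×_)
open import Relation.Nullary using (¬_)
open import Relation.Binary.PropositionalEquality using (_≡_)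
open import Function.Bundles using (_↔_; _⇔_; Inverse)
open import Level using (0ℓ; suc)

record BipGraph (s t : ℕ) : Set₁ where
  field
    adj : Fin s → Fin t → Set

-- A digraph on vertex set Fin n: arc relation, no loops.
-- (Multiple arcs are excluded automatically since arcs form a relation.)
record Digraph (n : ℕ) : Set₁ where
  field
    arc    : Fin n → Fin n → Set
    noLoop : ∀ i → ¬ arc i i

B : ∀ {n} → Digraph n → BipGraph n n
B D = record { adj = λ i j → Digraph.arc D i j ⊎ i ≡ j }

record BipIso {s t s' t' : ℕ} (G : BipGraph s t) (H : BipGraph s' t') : Set where
  field
    φS  : Fin s ↔ Fin s'
    φT  : Fin t ↔ Fin t'
    pres : ∀ x y → BipGraph.adj G x y ⇔ BipGraph.adj H (Inverse.to φS x) (Inverse.to φT y)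

-- A perfect matching: a set of pairwise disjoint edges covering every vertex,
-- i.e. a bijection S ↔ T whose pairs are edges.
record PerfectMatching {s t : ℕ} (G : BipGraph s t) : Set where
  field
    match  : Fin s ↔ Fin t
    isEdge : ∀ x → BipGraph.adj G x (Inverse.to match x)

module Submission where

-- Relabelling the second part along a perfect matching M makes M the
-- diagonal, so G becomes B(D) for the digraph with an arc i → j exactly when
-- i is adjacent to M j and i ≠ j. Conversely, the diagonal i ~ i' of B(D) is a
-- perfect matching, which any part-preserving isomorphism carries back to G;
-- and a bijection between the parts forces |S| = |T|.

open import Defs
open import Data.Nat using (ℕ)
open import Data.Product using (Σ; _×_; _,_; proj₂)
open import Data.Sum using (inj₁; inj₂)
open import Data.Fin using (_≟_)
open import Data.Fin.Permutation using (↔⇒≡)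
open import Relation.Nullary using (¬_; yes; no)
open import Relation.Binary.PropositionalEquality using (_≡_; refl; sym; subst)
open import Function.Bundles using (_⇔_; Inverse; Equivalence; mk⇔)
open import Function.Properties.Inverse using (↔-sym; ↔-trans; ↔-refl)

module _ {s t n : ℕ} {G : BipGraph s t} (D : Digraph n) (iso : BipIso G (B D)) where
  open BipIso iso

  perfectMatching-of-BipIso : PerfectMatching G
  perfectMatching-of-BipIso = record
    { match  = ↔-trans φS (↔-sym φT)
    ; isEdge = λ x → Equivalence.from (pres x _)
                       (inj₂ (sym (Inverse.strictlyInverseˡ φT (Inverse.to φS x))))
    }

module _ {n : ℕ} {G : BipGraph n n} (pm : PerfectMatching G) where
  open BipGraph G
  open PerfectMatching pm
  open Inverse match using (to; from; strictlyInverseˡ)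

  matchingDigraph : Digraph n
  matchingDigraph = record
    { arc    = λ i j → adj i (to j) × ¬ i ≡ j
    ; noLoop = λ i arc-ii → proj₂ arc-ii refl
    }

  adj⇔adj-B-matchingDigraph : ∀ x y → adj x y ⇔ BipGraph.adj (B matchingDigraph) x (from y)
  adj⇔adj-B-matchingDigraph x y = mk⇔ forward backward
    where
    forward : adj x y → BipGraph.adj (B matchingDigraph) x (from y)
    forward x~y with x ≟ from y
    ... | yes x≡from-y = inj₂ x≡from-y
    ... | no  x≢from-y = inj₁ (subst (adj x) (sym (strictlyInverseˡ y)) x~y , x≢from-y)

    backward : BipGraph.adj (B matchingDigraph) x (from y) → adj x y
    backward (inj₁ (x~to-from-y , _)) = subst (adj x) (strictlyInverseˡ y) x~to-from-y
    backward (inj₂ refl)              = subst (adj x) (strictlyInverseˡ y) (isEdge x)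

  BipIso-B-matchingDigraph : BipIso G (B matchingDigraph)
  BipIso-B-matchingDigraph = record
    { φS   = ↔-refl
    ; φT   = ↔-sym match
    ; pres = adj⇔adj-B-matchingDigraph
    }

lemma1 : ∀ {s t : ℕ} (G : BipGraph s t) →
    (Σ ℕ (λ n → Σ (Digraph n) (λ D → BipIso G (B D)))) ⇔ (s ≡ t × PerfectMatching G)
lemma1 {s} {t} G = mk⇔ incidence⇒matching matching⇒incidence
  where
  incidence⇒matching : Σ ℕ (λ n → Σ (Digraph n) (λ D → BipIso G (B D))) → s ≡ t × PerfectMatching G
  incidence⇒matching (_ , D , iso) = ↔⇒≡ (PerfectMatching.match pm) , pm
    where
    pm : PerfectMatching G
    pm = perfectMatching-of-BipIso D iso

  matching⇒incidence : s ≡ t × PerfectMatching G → Σ ℕ (λ n → Σ (Digraph n) (λ D → BipIso G (B D)))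
  matching⇒incidence (refl , pm) = s , matchingDigraph pm , BipIso-B-matchingDigraph pm
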